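{- Let $\mathbb{V}=U\oplus W$ be an $n$-dimensional vector space over a finite field $\mathcal{F}$ with $q$ elements, where $U,W$ are nonzero subspaces with $\dim U=r$, $\dim W=s$, $r+s=n\ge 2$. Then the order of the direct sum graph $\Gamma_{U\oplus W}(\mathbb{V})$ is $(q^r-1)(q^s-1)$ and its size (number of edges) is $$\frac{\big(q^{2r}-(2q-1)^r\big)\big(q^{2s}-(2q-1)^s\big)-(q^r-1)(q^s-1)}{2}.$$
   Context: Fix a basis $\{\alpha_1,\dots,\alpha_r\}$ of $U$ and a basis $\{\beta_1,\dots,\beta_s\}$ of $W$; every $x\in\mathbb{V}$ is written uniquely as $x=\sum_i a_i\alpha_i+\sum_j b_j\beta_j$. The direct sum graph $\Gamma_{U\oplus W}(\mathbb{V})$ is the simple graph whose vertex set is $\{x=u+w: u\in U, w\in W, u\neq 0, w\neq 0\}$, in which two distinct vertices $x,y$ are adjacent iff there is an index $i$ such that the coefficient of $\alpha_i$ is nonzero in both $x$ and $y$, and there is an index $j$ such that the coefficient of $\beta_j$ is nonzero in both $x$ and $y$. -}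

module Defs where

open import Level using (Level; _⊔_) renaming (suc to lsuc)
open import Data.Nat using (ℕ; _≡ᵇ_; _<ᵇ_)
open import Data.Bool using (Bool; true; false; _∧_; _∨_; not; T)
open import Data.Fin using (Fin; toℕ)
open import Data.Vec using (Vec; []; _∷_; _++_)
open import Data.Product using (Σ; ∃; _×_; _,_; proj₁)
open import Relation.Nullary using (¬_)
open import Relation.Binary.PropositionalEquality using (_≡_)
open import Function.Bundles using (_↔_; Inverse)
open import Algebra.Bundles using (CommutativeRing)

record FiniteField (q : ℕ) (c ℓ : Level) : Set (lsuc (c ⊔ ℓ)) where
  field
    commRing : CommutativeRing c ℓ
  open CommutativeRing commRing public
  field
    ≈⇒≡      : ∀ {x y} → x ≈ y → x ≡ y
    0≉1      : ¬ (0# ≈ 1#)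
    inverse  : ∀ x → ¬ (x ≈ 0#) → ∃ λ y → x * y ≈ 1#
    enum     : Fin q ↔ Carrier

-- The direct sum graph of V = U ⊕ W, dim U = r, dim W = s, with V identified
-- with F^r × F^s via the coordinates w.r.t. the fixed bases α and β.
module DirectSumGraph {q : ℕ} {c ℓ : Level} (F : FiniteField q c ℓ) (r s : ℕ) where
  open FiniteField F

  -- index of a field element in the enumeration (decides equality)
  key : Carrier → ℕ
  key x = toℕ (Inverse.from enum x)

  nz : Carrier → Bool
  nz x = not (key x ≡ᵇ key 0#)

  nonzeroVec : ∀ {k} → Vec Carrier k → Bool
  nonzeroVec []       = false
  nonzeroVec (x ∷ xs) = nz x ∨ nonzeroVec xs

  shareNZ : ∀ {k} → Vec Carrier k → Vec Carrier k → Bool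
  shareNZ []       []       = false
  shareNZ (x ∷ xs) (y ∷ ys) = (nz x ∧ nz y) ∨ shareNZ xs ys

  -- strict lexicographic order (used only to count each unordered edge once)
  ltVec : ∀ {k} → Vec Carrier k → Vec Carrier k → Bool
  ltVec []       []       = false
  ltVec (x ∷ xs) (y ∷ ys) = (key x <ᵇ key y) ∨ ((key x ≡ᵇ key y) ∧ ltVec xs ys)

  Vspace : Set c
  Vspace = Vec Carrier r × Vec Carrier s

  -- x = u + w with u ≠ 0 and w ≠ 0
  isVertex : Vspace → Bool
  isVertex (a , b) = nonzeroVec a ∧ nonzeroVec b

  Vertex : Set c
  Vertex = Σ Vspace (λ x → T (isVertex x))

  -- adjacency condition (for distinct vertices)
  adjacent : Vspace → Vspace → Bool
  adjacent (a , b) (a' , b') = shareNZ a a' ∧ shareNZ b b'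

  ltV : Vspace → Vspace → Bool
  ltV (a , b) (a' , b') = ltVec (a ++ b) (a' ++ b')

  -- edges: unordered pairs {x,y} of distinct adjacent vertices, represented
  -- canonically as (x , y) with x < y
  Edge : Set c
  Edge = Σ Vertex λ x → Σ Vertex λ y →
           T (ltV (proj₁ x) (proj₁ y) ∧ adjacent (proj₁ x) (proj₁ y))

-- A vector has q^k − 1 nonzero choices, so there are
-- (q^r − 1)(q^s − 1) vertices. A pair of coordinates fails to be "nonzero in
-- both" in q² − (q − 1)² = 2q − 1 ways, hence (2q − 1)^k pairs of k-vectors
-- share no nonzero coordinate, and the ordered pairs (x , y) sharing a nonzero
-- α-coordinate and a nonzero β-coordinate number
-- N = (q^{2r} − (2q − 1)^r)(q^{2s} − (2q − 1)^s). These are the adjacent pairs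
-- together with the diagonal pairs (x , x) of vertices; splitting them by a
-- strict total order into x < y, y < x and x = y gives N = 2e + v.

module Submission where

open import Defs
open import Level using (Level)
open import Data.Nat using (ℕ; zero; suc; _≤_; _+_; _*_; _∸_; _^_; _/_; _≡ᵇ_; _<ᵇ_)
import Data.Nat.Properties as ℕ
open import Data.Nat.DivMod using (m*n/n≡m)
open import Data.Nat.Solver using (module +-*-Solver)
open import Data.Fin using (Fin) renaming (zero to fzero; suc to fsuc)
open import Data.Fin.Properties using (+↔⊎; *↔×; toℕ-injective)
open import Data.Fin.Permutation using (↔⇒≡)
open import Data.Bool using (Bool; true; false; T; not; _∧_; _∨_; if_then_else_)
open import Data.Bool.Properties using (T-∧; T-∨; T-irrelevant; not-involutive)
open import Data.Unit using (tt)
open import Data.Empty using (⊥-elim)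
open import Data.Product using (Σ; _×_; _,_; proj₁; proj₂)
open import Data.Product.Algebra using (×-cong)
open import Data.Sum using (_⊎_; inj₁; inj₂)
open import Data.Sum.Algebra using (⊎-cong; ⊎-comm)
open import Data.Vec using (Vec; []; _∷_; _++_; replicate)
open import Data.Vec.Properties using (++-injective)
open import Function using (_∘_)
open import Function.Bundles using (_↔_; Inverse; Equivalence; mk↔ₛ′)
open import Function.Properties.Inverse using (↔-refl; ↔-sym; ↔-trans)
open import Relation.Binary.PropositionalEquality using (_≡_; refl; sym; trans; cong; cong₂; subst; module ≡-Reasoning)
open import Relation.Binary.Definitions using (tri<; tri≈; tri>)
open import Relation.Nullary using (¬_)

private
  variable
    a b : Level
    A X : Set a
    B Y : Set b
    k m n : ℕ

T-∧⁻ : ∀ x {y} → T (x ∧ y) → T x × T y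
T-∧⁻ x = Equivalence.to (T-∧ {x})

T-∧⁺ : ∀ x {y} → T x → T y → T (x ∧ y)
T-∧⁺ x p q = Equivalence.from (T-∧ {x}) (p , q)

T-∨⁻ : ∀ x {y} → T (x ∨ y) → T x ⊎ T y
T-∨⁻ x = Equivalence.to (T-∨ {x})

T-∨⁺ˡ : ∀ x {y} → T x → T (x ∨ y)
T-∨⁺ˡ x p = Equivalence.from (T-∨ {x}) (inj₁ p)

T-∨⁺ʳ : ∀ x {y} → T y → T (x ∨ y)
T-∨⁺ʳ x p = Equivalence.from (T-∨ {x}) (inj₂ p)

T-not⁻ : ∀ x → T (not x) → ¬ T x
T-not⁻ false _ ()

T-not⁺ : ∀ x → ¬ T x → T (not x)
T-not⁺ true  ¬p = ¬p tt
T-not⁺ false _  = tt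

T-not-∨⁻ : ∀ x {y} → T (not (x ∨ y)) → T (not x) × T (not y)
T-not-∨⁻ false p = tt , p

T-not-∨⁺ : ∀ x {y} → T (not x) → T (not y) → T (not (x ∨ y))
T-not-∨⁺ false _ q = q

T-not-not⁻ : ∀ x → T (not (not x)) → T x
T-not-not⁻ x = subst T (not-involutive x)

ΣT : (A : Set a) → (A → Bool) → Set a
ΣT A P = Σ A (T ∘ P)

ΣT-≡ : {P : A → Bool} {x y : ΣT A P} → proj₁ x ≡ proj₁ y → x ≡ y
ΣT-≡ {x = x , p} {y = .x , q} refl = cong (x ,_) (T-irrelevant p q)

ΣT-cong : {P : A → Bool} {Q : B → Bool} (e : A ↔ B) →
          (∀ {x} → T (P x) → T (Q (Inverse.to e x))) →
          (∀ {y} → T (Q y) → T (P (Inverse.from e y))) →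
          ΣT A P ↔ ΣT B Q
ΣT-cong e P⇒Q Q⇒P = mk↔ₛ′ (λ (x , p) → to x , P⇒Q p) (λ (y , q) → from y , Q⇒P q)
  (λ (y , _) → ΣT-≡ (strictlyInverseˡ y)) (λ (x , _) → ΣT-≡ (strictlyInverseʳ x))
  where open Inverse e

ΣT-×↔× : (P : A → Bool) (Q : B → Bool) →
         ΣT (A × B) (λ (x , y) → P x ∧ Q y) ↔ (ΣT A P × ΣT B Q)
ΣT-×↔× P Q = mk↔ₛ′
  (λ ((x , y) , t) → let p , q = T-∧⁻ (P x) t in (x , p) , (y , q))
  (λ ((x , p) , (y , q)) → (x , y) , T-∧⁺ (P x) p q)
  (λ _ → cong₂ _,_ (ΣT-≡ refl) (ΣT-≡ refl))
  (λ _ → ΣT-≡ refl)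

ΣT-ΣT↔ΣT-∧ : (P Q : A → Bool) → ΣT (ΣT A Q) (P ∘ proj₁) ↔ ΣT A (λ x → P x ∧ Q x)
ΣT-ΣT↔ΣT-∧ P Q = mk↔ₛ′
  (λ ((x , q) , p) → x , T-∧⁺ (P x) p q)
  (λ (x , t) → let p , q = T-∧⁻ (P x) t in (x , q) , p)
  (λ _ → ΣT-≡ refl)
  (λ _ → ΣT-≡ (ΣT-≡ refl))

ΣT-split : (P : A → Bool) → (ΣT A P ⊎ ΣT A (not ∘ P)) ↔ A
ΣT-split {A = A} P = mk↔ₛ′ forget decide (λ x → [decide] x (P x) refl) (λ y → decide[] y)
  where
  forget : ΣT A P ⊎ ΣT A (not ∘ P) → A
  forget (inj₁ (x , _)) = x
  forget (inj₂ (x , _)) = x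

  decideBy : ∀ x b → P x ≡ b → ΣT A P ⊎ ΣT A (not ∘ P)
  decideBy x true  eq = inj₁ (x , subst T (sym eq) tt)
  decideBy x false eq = inj₂ (x , subst (T ∘ not) (sym eq) tt)

  decide : A → ΣT A P ⊎ ΣT A (not ∘ P)
  decide x = decideBy x (P x) refl

  [decide] : ∀ x b (eq : P x ≡ b) → forget (decideBy x b eq) ≡ x
  [decide] x true  _ = refl
  [decide] x false _ = refl

  decideBy-inj₁ : ∀ x p b (eq : P x ≡ b) → decideBy x b eq ≡ inj₁ (x , p)
  decideBy-inj₁ x p true  _  = cong inj₁ (ΣT-≡ refl)
  decideBy-inj₁ x p false eq = ⊥-elim (subst T eq p)

  decideBy-inj₂ : ∀ x p b (eq : P x ≡ b) → decideBy x b eq ≡ inj₂ (x , p)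
  decideBy-inj₂ x p true  eq = ⊥-elim (subst (T ∘ not) eq p)
  decideBy-inj₂ x p false _  = cong inj₂ (ΣT-≡ refl)

  decide[] : ∀ y → decide (forget y) ≡ y
  decide[] (inj₁ (x , p)) = decideBy-inj₁ x p (P x) refl
  decide[] (inj₂ (x , p)) = decideBy-inj₂ x p (P x) refl

ΣT-split-∧ : (P Q : A → Bool) →
             (ΣT A (λ x → P x ∧ Q x) ⊎ ΣT A (λ x → not (P x) ∧ Q x)) ↔ ΣT A Q
ΣT-split-∧ P Q = ↔-trans
  (⊎-cong (↔-sym (ΣT-ΣT↔ΣT-∧ P Q)) (↔-sym (ΣT-ΣT↔ΣT-∧ (not ∘ P) Q)))
  (ΣT-split (P ∘ proj₁))

↔Fin-cast : m ≡ n → A ↔ Fin m → A ↔ Fin n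
↔Fin-cast refl e = e

singleton↔Fin1 : (x : A) → (∀ y → y ≡ x) → A ↔ Fin 1
singleton↔Fin1 x unique = mk↔ₛ′ (λ _ → fzero) (λ _ → x)
  (λ { fzero → refl ; (fsuc ()) }) (λ y → sym (unique y))

T↔Fin : ∀ x → T x ↔ Fin (if x then 1 else 0)
T↔Fin true  = singleton↔Fin1 tt (λ _ → refl)
T↔Fin false = mk↔ₛ′ (λ ()) (λ ()) (λ ()) (λ ())

ΣT-Fin-finite : ∀ n (P : Fin n → Bool) → Σ ℕ λ k → ΣT (Fin n) P ↔ Fin k
ΣT-Fin-finite zero    P = 0 , mk↔ₛ′ (λ ()) (λ ()) (λ ()) (λ ())
ΣT-Fin-finite (suc n) P =
  let k , e = ΣT-Fin-finite n (P ∘ fsuc)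
  in _ , ↔-trans uncons (↔-trans (⊎-cong (T↔Fin (P fzero)) e) (↔-sym +↔⊎))
  where
  uncons : ΣT (Fin (suc n)) P ↔ (T (P fzero) ⊎ ΣT (Fin n) (P ∘ fsuc))
  uncons = mk↔ₛ′ (λ { (fzero , p) → inj₁ p ; (fsuc i , p) → inj₂ (i , p) })
                 (λ { (inj₁ p) → fzero , p ; (inj₂ (i , p)) → fsuc i , p })
                 (λ { (inj₁ _) → refl ; (inj₂ _) → refl })
                 (λ { (fzero , _) → refl ; (fsuc _ , _) → refl })

ΣT-finite : A ↔ Fin n → (P : A → Bool) → Σ ℕ λ k → ΣT A P ↔ Fin k
ΣT-finite {n = n} e P =
  let k , e′ = ΣT-Fin-finite n (P ∘ Inverse.from e)
  in k , ↔-trans (ΣT-cong e (subst (T ∘ P) (sym (Inverse.strictlyInverseʳ e _))) (λ q → q)) e′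

⊎-size : (X ⊎ Y) ↔ Fin n → X ↔ Fin k → Y ↔ Fin m → k + m ≡ n
⊎-size e eX eY = ↔⇒≡ (↔-trans +↔⊎ (↔-trans (⊎-cong (↔-sym eX) (↔-sym eY)) e))

⊎-size-∸ : (X ⊎ Y) ↔ Fin n → X ↔ Fin k → Y ↔ Fin m → X ↔ Fin (n ∸ m)
⊎-size-∸ {k = k} {m = m} e eX eY =
  ↔Fin-cast (trans (sym (ℕ.m+n∸n≡m k m)) (cong (_∸ m) (⊎-size e eX eY))) eX

ΣT-size-∸ : {P : A → Bool} → A ↔ Fin n → ΣT A (not ∘ P) ↔ Fin m → ΣT A P ↔ Fin (n ∸ m)
ΣT-size-∸ {P = P} e e¬P =
  ⊎-size-∸ (↔-trans (ΣT-split P) e) (proj₂ (ΣT-finite e P)) e¬P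

ΣT-not-size-∸ : {P : A → Bool} → A ↔ Fin n → ΣT A P ↔ Fin m → ΣT A (not ∘ P) ↔ Fin (n ∸ m)
ΣT-not-size-∸ {P = P} e eP =
  ⊎-size-∸ (↔-trans (⊎-comm _ _) (↔-trans (ΣT-split P) e)) (proj₂ (ΣT-finite e (not ∘ P))) eP

×-size : A ↔ Fin m → B ↔ Fin n → (A × B) ↔ Fin (m * n)
×-size eA eB = ↔-trans (×-cong eA eB) (↔-sym *↔×)

Vec-size : A ↔ Fin n → ∀ k → Vec A k ↔ Fin (n ^ k)
Vec-size e zero    = singleton↔Fin1 [] (λ { [] → refl })
Vec-size e (suc k) = ↔-trans uncons (×-size e (Vec-size e k))
  where
  uncons : Vec _ (suc k) ↔ (_ × Vec _ k)
  uncons = mk↔ₛ′ (λ { (x ∷ xs) → x , xs }) (λ (x , xs) → x ∷ xs)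
                 (λ _ → refl) (λ { (_ ∷ _) → refl })

^-double : ∀ q k → q ^ (2 * k) ≡ q ^ k * q ^ k
^-double q k = trans (cong (λ j → q ^ (k + j)) (ℕ.+-identityʳ k)) (ℕ.^-distribˡ-+-* q k k)

square∸pred-square : ∀ q → q * q ∸ (q ∸ 1) * (q ∸ 1) ≡ 2 * q ∸ 1
square∸pred-square zero    = refl
square∸pred-square (suc p) = begin
  suc p * suc p ∸ p * p          ≡⟨ cong (_∸ p * p) (expand p) ⟩
  (p + suc p) + p * p ∸ p * p    ≡⟨ ℕ.m+n∸n≡m (p + suc p) (p * p) ⟩
  p + suc p                      ≡⟨ cong (p +_) (sym (ℕ.+-identityʳ (suc p))) ⟩
  2 * suc p ∸ 1                  ∎
  where
  open ≡-Reasoning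
  open +-*-Solver
  expand : ∀ p → suc p * suc p ≡ (p + suc p) + p * p
  expand = solve 1 (λ p → (con 1 :+ p) :* (con 1 :+ p) := (p :+ (con 1 :+ p)) :+ p :* p) refl

half-of-double-plus : ∀ e d N → e + (e + d) ≡ N → e ≡ (N ∸ d) / 2
half-of-double-plus e d N h = sym (begin
  (N ∸ d) / 2                ≡⟨ cong (λ z → (z ∸ d) / 2) (sym h) ⟩
  (e + (e + d) ∸ d) / 2      ≡⟨ cong (λ z → (z ∸ d) / 2) (sym (ℕ.+-assoc e e d)) ⟩
  ((e + e) + d ∸ d) / 2      ≡⟨ cong (_/ 2) (ℕ.m+n∸n≡m (e + e) d) ⟩
  (e + e) / 2                ≡⟨ cong (λ z → (e + z) / 2) (sym (ℕ.+-identityʳ e)) ⟩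
  (2 * e) / 2                ≡⟨ cong (_/ 2) (ℕ.*-comm 2 e) ⟩
  (e * 2) / 2                ≡⟨ m*n/n≡m e 2 ⟩
  e                          ∎)
  where open ≡-Reasoning

module SymmetricPairs {X : Set a} (_<_ R : X → X → Bool)
  (<-asym : ∀ x y → T (x < y) → ¬ T (y < x))
  (<-connex : ∀ x y → ¬ T (x < y) → ¬ T (y < x) → x ≡ y)
  (R-sym : ∀ x y → T (R x y) → T (R y x))
  where

  related : X × X → Bool
  related (x , y) = R x y

  increasing decreasing : X × X → Bool
  increasing (x , y) = x < y
  decreasing (x , y) = y < x

  Increasing : Set a
  Increasing = ΣT (X × X) (λ z → increasing z ∧ related z)

  private
    notIncreasing : X × X → Bool
    notIncreasing z = not (increasing z) ∧ related z

    Decreasing Diagonal : Set a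
    Decreasing = ΣT (X × X) (λ z → decreasing z ∧ notIncreasing z)
    Diagonal   = ΣT (X × X) (λ z → not (decreasing z) ∧ notIncreasing z)

    swap↔ : (X × X) ↔ (X × X)
    swap↔ = mk↔ₛ′ (λ (x , y) → y , x) (λ (x , y) → y , x) (λ _ → refl) (λ _ → refl)

    Decreasing↔Increasing : Decreasing ↔ Increasing
    Decreasing↔Increasing = ΣT-cong swap↔
      (λ {(x , y)} t → let y<x , t′ = T-∧⁻ (y < x) t in
        T-∧⁺ (y < x) y<x (R-sym x y (proj₂ (T-∧⁻ (not (x < y)) t′))))
      (λ {(x , y)} t → let x<y , Rxy = T-∧⁻ (x < y) t in
        T-∧⁺ (x < y) x<y (T-∧⁺ (not (y < x)) (T-not⁺ _ (<-asym x y x<y)) (R-sym x y Rxy)))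

    on-diagonal : ∀ {x y} → T (not (y < x) ∧ (not (x < y) ∧ R x y)) → x ≡ y × T (R x y)
    on-diagonal {x} {y} t =
      let y≮x , t′ = T-∧⁻ (not (y < x)) t
          x≮y , Rxy = T-∧⁻ (not (x < y)) t′
      in <-connex x y (T-not⁻ _ x≮y) (T-not⁻ _ y≮x) , Rxy

    Diagonal↔ : Diagonal ↔ ΣT X (λ x → R x x)
    Diagonal↔ = mk↔ₛ′
      (λ ((x , y) , t) → let x≡y , Rxy = on-diagonal t in x , subst (T ∘ R x) (sym x≡y) Rxy)
      (λ (x , Rxx) → let x≮x = T-not⁺ _ (λ x<x → <-asym x x x<x x<x) in
        (x , x) , T-∧⁺ (not (x < x)) x≮x (T-∧⁺ (not (x < x)) x≮x Rxx))
      (λ _ → ΣT-≡ refl)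
      (λ ((x , y) , t) → ΣT-≡ (cong (x ,_) (proj₁ (on-diagonal t))))

  related↔ : ΣT (X × X) related ↔ (Increasing ⊎ (Increasing ⊎ ΣT X (λ x → R x x)))
  related↔ = ↔-sym (↔-trans
    (⊎-cong ↔-refl (↔-sym (⊎-cong Decreasing↔Increasing Diagonal↔)))
    (↔-trans (⊎-cong ↔-refl (ΣT-split-∧ decreasing notIncreasing)) (ΣT-split-∧ increasing related)))

  Increasing-size : X ↔ Fin n → ΣT (X × X) related ↔ Fin m → ΣT X (λ x → R x x) ↔ Fin k →
                    Increasing ↔ Fin ((m ∸ k) / 2)
  Increasing-size {k = k} eX eR eD =
    let e , eI = ΣT-finite (×-size eX eX) (λ z → increasing z ∧ related z)
        total  = ⊎-size (↔-trans (↔-sym related↔) eR) eI (↔-trans (⊎-cong eI eD) (↔-sym +↔⊎))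
    in ↔Fin-cast (half-of-double-plus e k _ total) eI

module DirectSumGraphSize {q : ℕ} {c ℓ : Level} (F : FiniteField q c ℓ) (r s : ℕ) where
  open FiniteField F using (Carrier; 0#; enum)
  open DirectSumGraph F r s

  key-injective : ∀ {x y} → key x ≡ key y → x ≡ y
  key-injective {x} {y} eq = begin
    x                                    ≡⟨ Inverse.strictlyInverseˡ enum x ⟨
    Inverse.to enum (Inverse.from enum x) ≡⟨ cong (Inverse.to enum) (toℕ-injective eq) ⟩
    Inverse.to enum (Inverse.from enum y) ≡⟨ Inverse.strictlyInverseˡ enum y ⟩
    y                                    ∎
    where open ≡-Reasoning

  ¬nz⇒≡0 : ∀ x → T (not (nz x)) → x ≡ 0#
  ¬nz⇒≡0 x t = key-injective (ℕ.≡ᵇ⇒≡ _ _ (T-not-not⁻ _ t))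

  ¬nz-0 : T (not (nz 0#))
  ¬nz-0 = subst T (sym (not-involutive _)) (ℕ.≡⇒≡ᵇ (key 0#) (key 0#) refl)

  Carrier-size : Carrier ↔ Fin q
  Carrier-size = ↔-sym enum

  nz-size : ΣT Carrier nz ↔ Fin (q ∸ 1)
  nz-size = ΣT-size-∸ Carrier-size (singleton↔Fin1 (0# , ¬nz-0) (λ (x , t) → ΣT-≡ (¬nz⇒≡0 x t)))

  ¬nonzeroVec⇒≡replicate : ∀ {k} (v : Vec Carrier k) → T (not (nonzeroVec v)) → v ≡ replicate k 0#
  ¬nonzeroVec⇒≡replicate []       _ = refl
  ¬nonzeroVec⇒≡replicate (x ∷ xs) t =
    let ¬nzx , ¬nzxs = T-not-∨⁻ (nz x) t
    in cong₂ _∷_ (¬nz⇒≡0 x ¬nzx) (¬nonzeroVec⇒≡replicate xs ¬nzxs)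

  ¬nonzeroVec-replicate : ∀ k → T (not (nonzeroVec (replicate k 0#)))
  ¬nonzeroVec-replicate zero    = tt
  ¬nonzeroVec-replicate (suc k) = T-not-∨⁺ (nz 0#) ¬nz-0 (¬nonzeroVec-replicate k)

  nonzeroVec-size : ∀ k → ΣT (Vec Carrier k) nonzeroVec ↔ Fin (q ^ k ∸ 1)
  nonzeroVec-size k = ΣT-size-∸ (Vec-size Carrier-size k)
    (singleton↔Fin1 (replicate k 0# , ¬nonzeroVec-replicate k)
            (λ (v , t) → ΣT-≡ (¬nonzeroVec⇒≡replicate v t)))

  Vertex-size : Vertex ↔ Fin ((q ^ r ∸ 1) * (q ^ s ∸ 1))
  Vertex-size = ↔-trans (ΣT-×↔× nonzeroVec nonzeroVec) (×-size (nonzeroVec-size r) (nonzeroVec-size s))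

  bothNonzero : Carrier × Carrier → Bool
  bothNonzero (x , y) = nz x ∧ nz y

  ¬bothNonzero-size : ΣT (Carrier × Carrier) (not ∘ bothNonzero) ↔ Fin (2 * q ∸ 1)
  ¬bothNonzero-size = ↔Fin-cast (square∸pred-square q)
    (ΣT-not-size-∸ (×-size Carrier-size Carrier-size)
      (↔-trans (ΣT-×↔× nz nz) (×-size nz-size nz-size)))

  sharing : ∀ {k} → Vec Carrier k × Vec Carrier k → Bool
  sharing (u , v) = shareNZ u v

  ¬sharing-size : ∀ k → ΣT (Vec Carrier k × Vec Carrier k) (not ∘ sharing) ↔ Fin ((2 * q ∸ 1) ^ k)
  ¬sharing-size zero    = singleton↔Fin1 (([] , []) , tt) (λ { (([] , []) , _) → refl })
  ¬sharing-size (suc k) = ↔-trans uncons (×-size ¬bothNonzero-size (¬sharing-size k))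
    where
    uncons : ΣT (Vec Carrier (suc k) × Vec Carrier (suc k)) (not ∘ sharing) ↔
             (ΣT (Carrier × Carrier) (not ∘ bothNonzero) × ΣT (Vec Carrier k × Vec Carrier k) (not ∘ sharing))
    uncons = mk↔ₛ′
      (λ { ((x ∷ xs , y ∷ ys) , t) → let p , q = T-not-∨⁻ (nz x ∧ nz y) t in ((x , y) , p) , ((xs , ys) , q) })
      (λ (((x , y) , p) , ((xs , ys) , q)) → (x ∷ xs , y ∷ ys) , T-not-∨⁺ (nz x ∧ nz y) p q)
      (λ _ → cong₂ _,_ (ΣT-≡ refl) (ΣT-≡ refl))
      (λ { ((_ ∷ _ , _ ∷ _) , _) → ΣT-≡ refl })

  sharing-size : ∀ k → ΣT (Vec Carrier k × Vec Carrier k) sharing ↔ Fin (q ^ (2 * k) ∸ (2 * q ∸ 1) ^ k)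
  sharing-size k = ↔Fin-cast (cong (_∸ (2 * q ∸ 1) ^ k) (sym (^-double q k)))
    (ΣT-size-∸ (×-size (Vec-size Carrier-size k) (Vec-size Carrier-size k)) (¬sharing-size k))

  adjacentPair : Vspace × Vspace → Bool
  adjacentPair (x , y) = adjacent x y

  adjacentPair-size : ΣT (Vspace × Vspace) adjacentPair ↔
                      Fin ((q ^ (2 * r) ∸ (2 * q ∸ 1) ^ r) * (q ^ (2 * s) ∸ (2 * q ∸ 1) ^ s))
  adjacentPair-size = ↔-trans (ΣT-cong transpose (λ t → t) (λ t → t))
    (↔-trans (ΣT-×↔× sharing sharing) (×-size (sharing-size r) (sharing-size s)))
    where
    transpose : (Vspace × Vspace) ↔ ((Vec Carrier r × Vec Carrier r) × (Vec Carrier s × Vec Carrier s))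
    transpose = mk↔ₛ′ (λ ((a , b) , (a′ , b′)) → (a , a′) , (b , b′))
                      (λ ((a , a′) , (b , b′)) → (a , b) , (a′ , b′)) (λ _ → refl) (λ _ → refl)

  shareNZ-sym : ∀ {k} (u v : Vec Carrier k) → T (shareNZ u v) → T (shareNZ v u)
  shareNZ-sym [] [] ()
  shareNZ-sym (x ∷ xs) (y ∷ ys) t with T-∨⁻ (nz x ∧ nz y) t
  ... | inj₁ h = let p , q = T-∧⁻ (nz x) h in T-∨⁺ˡ (nz y ∧ nz x) (T-∧⁺ (nz y) q p)
  ... | inj₂ h = T-∨⁺ʳ (nz y ∧ nz x) (shareNZ-sym xs ys h)

  shareNZ⇒nonzeroVec : ∀ {k} (u v : Vec Carrier k) → T (shareNZ u v) → T (nonzeroVec u)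
  shareNZ⇒nonzeroVec [] [] ()
  shareNZ⇒nonzeroVec (x ∷ xs) (y ∷ ys) t with T-∨⁻ (nz x ∧ nz y) t
  ... | inj₁ h = T-∨⁺ˡ (nz x) (proj₁ (T-∧⁻ (nz x) h))
  ... | inj₂ h = T-∨⁺ʳ (nz x) (shareNZ⇒nonzeroVec xs ys h)

  nonzeroVec⇒shareNZ-refl : ∀ {k} (u : Vec Carrier k) → T (nonzeroVec u) → T (shareNZ u u)
  nonzeroVec⇒shareNZ-refl [] ()
  nonzeroVec⇒shareNZ-refl (x ∷ xs) t with T-∨⁻ (nz x) t
  ... | inj₁ h = T-∨⁺ˡ (nz x ∧ nz x) (T-∧⁺ (nz x) h h)
  ... | inj₂ h = T-∨⁺ʳ (nz x ∧ nz x) (nonzeroVec⇒shareNZ-refl xs h)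

  adjacent-sym : ∀ x y → T (adjacent x y) → T (adjacent y x)
  adjacent-sym (a , b) (a′ , b′) t = let p , q = T-∧⁻ (shareNZ a a′) t in
    T-∧⁺ (shareNZ a′ a) (shareNZ-sym a a′ p) (shareNZ-sym b b′ q)

  adjacent⇒isVertex : ∀ x y → T (adjacent x y) → T (isVertex x)
  adjacent⇒isVertex (a , b) (a′ , b′) t = let p , q = T-∧⁻ (shareNZ a a′) t in
    T-∧⁺ (nonzeroVec a) (shareNZ⇒nonzeroVec a a′ p) (shareNZ⇒nonzeroVec b b′ q)

  isVertex⇒adjacent-refl : ∀ x → T (isVertex x) → T (adjacent x x)
  isVertex⇒adjacent-refl (a , b) t = let p , q = T-∧⁻ (nonzeroVec a) t in
    T-∧⁺ (shareNZ a a) (nonzeroVec⇒shareNZ-refl a p) (nonzeroVec⇒shareNZ-refl b q)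

  ltVec-asym : ∀ {k} (u v : Vec Carrier k) → T (ltVec u v) → ¬ T (ltVec v u)
  ltVec-asym [] [] ()
  ltVec-asym (x ∷ xs) (y ∷ ys) t t′ with T-∨⁻ (key x <ᵇ key y) t | T-∨⁻ (key y <ᵇ key x) t′
  ... | inj₁ x<y | inj₁ y<x = ℕ.<-asym (ℕ.<ᵇ⇒< (key x) (key y) x<y) (ℕ.<ᵇ⇒< (key y) (key x) y<x)
  ... | inj₁ x<y | inj₂ h   = ℕ.<-irrefl (sym (ℕ.≡ᵇ⇒≡ (key y) (key x) (proj₁ (T-∧⁻ (key y ≡ᵇ key x) h)))) (ℕ.<ᵇ⇒< (key x) (key y) x<y)
  ... | inj₂ h   | inj₁ y<x = ℕ.<-irrefl (sym (ℕ.≡ᵇ⇒≡ (key x) (key y) (proj₁ (T-∧⁻ (key x ≡ᵇ key y) h)))) (ℕ.<ᵇ⇒< (key y) (key x) y<x)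
  ... | inj₂ h   | inj₂ h′  = ltVec-asym xs ys (proj₂ (T-∧⁻ (key x ≡ᵇ key y) h)) (proj₂ (T-∧⁻ (key y ≡ᵇ key x) h′))

  ltVec-connex : ∀ {k} (u v : Vec Carrier k) → ¬ T (ltVec u v) → ¬ T (ltVec v u) → u ≡ v
  ltVec-connex []       []       _   _   = refl
  ltVec-connex (x ∷ xs) (y ∷ ys) u≮v v≮u with ℕ.<-cmp (key x) (key y)
  ... | tri< x<y _ _ = ⊥-elim (u≮v (T-∨⁺ˡ (key x <ᵇ key y) (ℕ.<⇒<ᵇ x<y)))
  ... | tri> _ _ y<x = ⊥-elim (v≮u (T-∨⁺ˡ (key y <ᵇ key x) (ℕ.<⇒<ᵇ y<x)))
  ... | tri≈ _ x≈y _ = cong₂ _∷_ (key-injective x≈y) (ltVec-connex xs ys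
        (λ h → u≮v (T-∨⁺ʳ (key x <ᵇ key y) (T-∧⁺ (key x ≡ᵇ key y) (ℕ.≡⇒≡ᵇ _ _ x≈y) h)))
        (λ h → v≮u (T-∨⁺ʳ (key y <ᵇ key x) (T-∧⁺ (key y ≡ᵇ key x) (ℕ.≡⇒≡ᵇ _ _ (sym x≈y)) h))))

  ltV-asym : ∀ x y → T (ltV x y) → ¬ T (ltV y x)
  ltV-asym (a , b) (a′ , b′) = ltVec-asym (a ++ b) (a′ ++ b′)

  ltV-connex : ∀ x y → ¬ T (ltV x y) → ¬ T (ltV y x) → x ≡ y
  ltV-connex (a , b) (a′ , b′) x≮y y≮x with ++-injective a a′ (ltVec-connex (a ++ b) (a′ ++ b′) x≮y y≮x)
  ... | refl , refl = refl

  open SymmetricPairs ltV adjacent ltV-asym ltV-connex adjacent-sym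

  Edge↔Increasing : Edge ↔ Increasing
  Edge↔Increasing = mk↔ₛ′
    (λ ((x , _) , (y , _) , t) → (x , y) , t)
    (λ ((x , y) , t) → let adj = proj₂ (T-∧⁻ (ltV x y) t) in
      (x , adjacent⇒isVertex x y adj) , (y , adjacent⇒isVertex y x (adjacent-sym x y adj)) , t)
    (λ _ → refl)
    (λ ((x , _) , (y , _) , t) → cong₂ (λ p p′ → (x , p) , (y , p′) , t) (T-irrelevant _ _) (T-irrelevant _ _))

  selfAdjacent↔Vertex : ΣT Vspace (λ x → adjacent x x) ↔ Vertex
  selfAdjacent↔Vertex = ΣT-cong ↔-refl (λ {x} → adjacent⇒isVertex x x) (λ {x} → isVertex⇒adjacent-refl x)

  Edge-size : Edge ↔ Fin ((((q ^ (2 * r) ∸ (2 * q ∸ 1) ^ r) * (q ^ (2 * s) ∸ (2 * q ∸ 1) ^ s))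
                          ∸ (q ^ r ∸ 1) * (q ^ s ∸ 1)) / 2)
  Edge-size = ↔-trans Edge↔Increasing
    (Increasing-size (×-size (Vec-size Carrier-size r) (Vec-size Carrier-size s))
      adjacentPair-size (↔-trans selfAdjacent↔Vertex Vertex-size))

theorem3p4 : ∀ {c ℓ} {q : ℕ} (F : FiniteField q c ℓ) (r s : ℕ) → 1 ≤ r → 1 ≤ s →
    (DirectSumGraph.Vertex F r s ↔ Fin ((q ^ r ∸ 1) * (q ^ s ∸ 1)))
    × (DirectSumGraph.Edge F r s ↔
         Fin ((((q ^ (2 * r) ∸ (2 * q ∸ 1) ^ r) * (q ^ (2 * s) ∸ (2 * q ∸ 1) ^ s))
               ∸ (q ^ r ∸ 1) * (q ^ s ∸ 1)) / 2))
theorem3p4 F r s _ _ = Vertex-size , Edge-size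
  where open DirectSumGraphSize F r s
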